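{- Let $G$ be a $K_{2,3}$-saturated graph with vertex set $V$, let $\alpha \in V$, and let $N(\alpha) = \{x_1, \dots, x_k\}$. If $y \in V \setminus N[\alpha]$, then either there exists $l$ such that $|N(y) \cap N(x_l)| \geq 2$, or there are $i \neq j$ such that $y$ is adjacent to a vertex in $N(x_i) \cap N(x_j)$. In particular, if $k = 1$, then every $y \in V \setminus N[\alpha]$ satisfies $|N(y) \cap N(x_1)| \geq 2$.
   Context: All graphs are finite and simple; $N(x)$ is the set of neighbors of $x$ and $N[x] = N(x) \cup \{x\}$. A graph $G$ is $K_{2,3}$-saturated if it contains no subgraph isomorphic to $K_{2,3}$, but adding any edge between two nonadjacent vertices creates a subgraph isomorphic to $K_{2,3}$. -}

module Defs where

open import Data.Nat using (ℕ)
open import Data.Bool using (Bool; true; false)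
open import Data.Fin using (Fin)
open import Data.Fin.Subset using (Subset; _∈_; _∉_)
open import Data.Vec using (tabulate)
open import Data.Product using (_×_; ∃-syntax)
open import Data.Sum using (_⊎_)
open import Relation.Binary.PropositionalEquality using (_≡_; _≢_)
open import Relation.Nullary using (¬_)

record Graph (n : ℕ) : Set where
  field
    adj   : Fin n → Fin n → Bool
    sym   : ∀ x y → adj x y ≡ adj y x
    irrefl : ∀ x → adj x x ≡ false
open Graph public

Edge : ∀ {n} → Graph n → Fin n → Fin n → Set
Edge G x y = adj G x y ≡ true

N : ∀ {n} → Graph n → Fin n → Subset n
N G x = tabulate (adj G x)

_∈N[_,_] : ∀ {n} → Fin n → Graph n → Fin n → Set
y ∈N[ G , x ] = (y ≡ x) ⊎ (y ∈ N G x)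

ContainsK23 : ∀ {n} → (Fin n → Fin n → Set) → Set
ContainsK23 {n} E = ∃[ a₁ ] ∃[ a₂ ] ∃[ b₁ ] ∃[ b₂ ] ∃[ b₃ ]
  ( a₁ ≢ a₂ × a₁ ≢ b₁ × a₁ ≢ b₂ × a₁ ≢ b₃
  × a₂ ≢ b₁ × a₂ ≢ b₂ × a₂ ≢ b₃
  × b₁ ≢ b₂ × b₁ ≢ b₃ × b₂ ≢ b₃
  × E a₁ b₁ × E a₁ b₂ × E a₁ b₃
  × E a₂ b₁ × E a₂ b₂ × E a₂ b₃ )

EdgePlus : ∀ {n} → Graph n → Fin n → Fin n → Fin n → Fin n → Set
EdgePlus G u v x y = Edge G x y ⊎ ((x ≡ u × y ≡ v) ⊎ (x ≡ v × y ≡ u))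

K23Saturated : ∀ {n} → Graph n → Set
K23Saturated G =
  ¬ ContainsK23 (Edge G) ×
  (∀ u v → u ≢ v → ¬ Edge G u v → ContainsK23 (EdgePlus G u v))

-- Since G has no K₂,₃ but G + αy has one, that copy uses the new edge αy, joining one
-- vertex a of the 2-side to one vertex b of the 3-side; all other edges of the copy lie in G.
-- If a = α, the other vertex of the 2-side is a neighbour of y adjacent to the two other
-- vertices of the 3-side, both neighbours of α. If a = y, it is a neighbour of α sharing
-- the two other vertices of the 3-side with y.
module Submission where

open import Defs
open import Data.Nat using (ℕ; zero; suc; _≥_; _≤_; s≤s; z≤n)
open import Data.Nat.Properties using (≤-trans)
open import Data.Fin using (Fin; zero; suc; punchIn)
open import Data.Fin.Properties using (∀-cons; punchInᵢ≢i; punchIn-injective; _≟_)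
open import Data.Fin.Subset using (Subset; _∈_; _∩_; ∣_∣)
open import Data.Fin.Subset.Properties using (x∈p∩q⁺; ∣p∣≤∣x∷p∣)
open import Data.Vec using (here; there)
open import Data.Vec.Properties using (lookup⇒[]=; lookup∘tabulate)
open import Data.Product using (_×_; ∃-syntax; _,_)
open import Data.Sum using (_⊎_; inj₁; inj₂)
open import Data.Empty using (⊥; ⊥-elim)
open import Function using (_∘_)
open import Function.Definitions using (Injective)
open import Relation.Binary.PropositionalEquality
  using (_≡_; _≢_; refl; trans; cong; subst; subst₂; ≢-sym)
  renaming (sym to ≡-sym)
open import Relation.Nullary using (¬_; yes; no)

private
  variable
    n : ℕ

∈⇒1≤∣p∣ : ∀ {x : Fin n} {p : Subset n} → x ∈ p → 1 ≤ ∣ p ∣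
∈⇒1≤∣p∣ here = s≤s z≤n
∈⇒1≤∣p∣ (there {y = b} {xs = p} x∈p) = ≤-trans (∈⇒1≤∣p∣ x∈p) (∣p∣≤∣x∷p∣ b p)

distinct-∈⇒2≤∣p∣ : ∀ {x y : Fin n} {p : Subset n} → x ∈ p → y ∈ p → x ≢ y → 2 ≤ ∣ p ∣
distinct-∈⇒2≤∣p∣ here      here      x≢y = ⊥-elim (x≢y refl)
distinct-∈⇒2≤∣p∣ here      (there y∈p) _ = s≤s (∈⇒1≤∣p∣ y∈p)
distinct-∈⇒2≤∣p∣ (there x∈p) here      _ = s≤s (∈⇒1≤∣p∣ x∈p)
distinct-∈⇒2≤∣p∣ (there {y = b} {xs = p} x∈p) (there y∈p) x≢y =
  ≤-trans (distinct-∈⇒2≤∣p∣ x∈p y∈p (x≢y ∘ cong suc)) (∣p∣≤∣x∷p∣ b p)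

∣p∣≡1⇒∈-unique : ∀ {x y : Fin n} {p : Subset n} → ∣ p ∣ ≡ 1 → x ∈ p → y ∈ p → x ≡ y
∣p∣≡1⇒∈-unique {x = x} {y} ∣p∣≡1 x∈p y∈p with x ≟ y
... | yes x≡y = x≡y
... | no x≢y with subst (2 ≤_) ∣p∣≡1 (distinct-∈⇒2≤∣p∣ x∈p y∈p x≢y)
...   | s≤s ()

all⊎any : ∀ {A B : Fin n → Set} → (∀ i → A i ⊎ B i) → (∀ i → A i) ⊎ ∃[ i ] B i
all⊎any {zero}  f = inj₁ λ ()
all⊎any {suc n} f with f zero | all⊎any (f ∘ suc)
... | inj₂ b | _            = inj₂ (zero , b)
... | inj₁ _ | inj₂ (i , b) = inj₂ (suc i , b)
... | inj₁ a | inj₁ as      = inj₁ (∀-cons a as)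

Edge⇒∈N : ∀ (G : Graph n) {x y} → Edge G x y → y ∈ N G x
Edge⇒∈N G {x} {y} e = lookup⇒[]= y _ (trans (lookup∘tabulate (adj G x) y) e)

Edge-sym : ∀ (G : Graph n) {x y} → Edge G x y → Edge G y x
Edge-sym G {x} {y} = trans (Graph.sym G y x)

ShareTwoNeighboursWithNeighbourOf : Graph n → Fin n → Fin n → Set
ShareTwoNeighboursWithNeighbourOf G α y = ∃[ x ] (x ∈ N G α × ∣ N G y ∩ N G x ∣ ≥ 2)

AdjacentToCommonNeighbourOfNeighboursOf : Graph n → Fin n → Fin n → Set
AdjacentToCommonNeighbourOfNeighboursOf G α y =
  ∃[ xi ] ∃[ xj ] ∃[ z ] (xi ∈ N G α × xj ∈ N G α × xi ≢ xj
    × z ∈ (N G xi ∩ N G xj) × Edge G y z)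

-- EdgePlus G u v x y unfolds to Edge G x y ⊎ SamePair u v x y.
SamePair : Fin n → Fin n → Fin n → Fin n → Set
SamePair u v x y = (x ≡ u × y ≡ v) ⊎ (x ≡ v × y ≡ u)

SamePair-swap : ∀ {u v x y : Fin n} → SamePair u v x y → SamePair u v y x
SamePair-swap (inj₁ (x≡u , y≡v)) = inj₂ (y≡v , x≡u)
SamePair-swap (inj₂ (x≡v , y≡u)) = inj₁ (y≡u , x≡v)

SamePair-endpoint : ∀ {u v x y x′ y′ : Fin n} →
  SamePair u v x y → SamePair u v x′ y′ → x′ ≡ x ⊎ x′ ≡ y
SamePair-endpoint (inj₁ (refl , refl)) (inj₁ (refl , _)) = inj₁ refl
SamePair-endpoint (inj₁ (refl , refl)) (inj₂ (refl , _)) = inj₂ refl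
SamePair-endpoint (inj₂ (refl , refl)) (inj₁ (refl , _)) = inj₂ refl
SamePair-endpoint (inj₂ (refl , refl)) (inj₂ (refl , _)) = inj₁ refl

EdgePlus⇒Edge : ∀ (G : Graph n) {u v x y} → EdgePlus G u v x y → ¬ SamePair u v x y → Edge G x y
EdgePlus⇒Edge G (inj₁ e) _       = e
EdgePlus⇒Edge G (inj₂ s) ¬same = ⊥-elim (¬same s)

record K23 (E : Fin n → Fin n → Set) : Set where
  field
    a           : Fin 2 → Fin n
    b           : Fin 3 → Fin n
    a-injective : Injective _≡_ _≡_ a
    b-injective : Injective _≡_ _≡_ b
    a≢b         : ∀ i j → a i ≢ b j
    edge        : ∀ i j → E (a i) (b j)

ContainsK23⇒K23 : ∀ {E : Fin n → Fin n → Set} → ContainsK23 E → K23 E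
ContainsK23⇒K23 {E = E}
  (a₁ , a₂ , b₁ , b₂ , b₃ , a₁≢a₂ , a₁≢b₁ , a₁≢b₂ , a₁≢b₃ , a₂≢b₁ , a₂≢b₂ , a₂≢b₃
      , b₁≢b₂ , b₁≢b₃ , b₂≢b₃ , e₁₁ , e₁₂ , e₁₃ , e₂₁ , e₂₂ , e₂₃) =
  record { a = a ; b = b ; a-injective = a-inj ; b-injective = b-inj ; a≢b = a≢b ; edge = edge }
  where
  a : Fin 2 → _
  a zero       = a₁
  a (suc zero) = a₂

  b : Fin 3 → _
  b zero             = b₁
  b (suc zero)       = b₂
  b (suc (suc zero)) = b₃

  a-inj : Injective _≡_ _≡_ a
  a-inj {zero}     {zero}     _ = refl
  a-inj {zero}     {suc zero} p = ⊥-elim (a₁≢a₂ p)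
  a-inj {suc zero} {zero}     p = ⊥-elim (≢-sym a₁≢a₂ p)
  a-inj {suc zero} {suc zero} _ = refl

  b-inj : Injective _≡_ _≡_ b
  b-inj {zero}             {zero}             _ = refl
  b-inj {zero}             {suc zero}         p = ⊥-elim (b₁≢b₂ p)
  b-inj {zero}             {suc (suc zero)}   p = ⊥-elim (b₁≢b₃ p)
  b-inj {suc zero}         {zero}             p = ⊥-elim (≢-sym b₁≢b₂ p)
  b-inj {suc zero}         {suc zero}         _ = refl
  b-inj {suc zero}         {suc (suc zero)}   p = ⊥-elim (b₂≢b₃ p)
  b-inj {suc (suc zero)}   {zero}             p = ⊥-elim (≢-sym b₁≢b₃ p)
  b-inj {suc (suc zero)}   {suc zero}         p = ⊥-elim (≢-sym b₂≢b₃ p)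
  b-inj {suc (suc zero)}   {suc (suc zero)}   _ = refl

  a≢b : ∀ i j → a i ≢ b j
  a≢b zero       zero             = a₁≢b₁
  a≢b zero       (suc zero)       = a₁≢b₂
  a≢b zero       (suc (suc zero)) = a₁≢b₃
  a≢b (suc zero) zero             = a₂≢b₁
  a≢b (suc zero) (suc zero)       = a₂≢b₂
  a≢b (suc zero) (suc (suc zero)) = a₂≢b₃

  edge : ∀ i j → E (a i) (b j)
  edge zero       zero             = e₁₁
  edge zero       (suc zero)       = e₁₂
  edge zero       (suc (suc zero)) = e₁₃
  edge (suc zero) zero             = e₂₁
  edge (suc zero) (suc zero)       = e₂₂
  edge (suc zero) (suc (suc zero)) = e₂₃

K23⇒ContainsK23 : ∀ {E : Fin n → Fin n → Set} → K23 E → ContainsK23 E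
K23⇒ContainsK23 K =
  a ₀ , a ₁ , b ₀ , b ₁ , b ₂
  , a-distinct (λ ()) , a≢b ₀ ₀ , a≢b ₀ ₁ , a≢b ₀ ₂ , a≢b ₁ ₀ , a≢b ₁ ₁ , a≢b ₁ ₂
  , b-distinct (λ ()) , b-distinct (λ ()) , b-distinct (λ ())
  , edge ₀ ₀ , edge ₀ ₁ , edge ₀ ₂ , edge ₁ ₀ , edge ₁ ₁ , edge ₁ ₂
  where
  open K23 K
  ₀ : ∀ {m} → Fin (suc m)
  ₀ = zero
  ₁ : ∀ {m} → Fin (suc (suc m))
  ₁ = suc zero
  ₂ : Fin 3
  ₂ = suc (suc zero)
  a-distinct : ∀ {i j} → i ≢ j → a i ≢ a j
  a-distinct i≢j = i≢j ∘ a-injective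
  b-distinct : ∀ {i j} → i ≢ j → b i ≢ b j
  b-distinct i≢j = i≢j ∘ b-injective

module _ (G : Graph n) {u v : Fin n} (K : K23 (EdgePlus G u v)) where
  open K23 K

  -- A second edge joining u and v would have both ends among a i and b j.
  K23-edges-in-G : ∀ {i j i′ j′} → SamePair u v (a i) (b j) → i′ ≢ i ⊎ j′ ≢ j →
                   Edge G (a i′) (b j′)
  K23-edges-in-G {i} {j} {i′} {j′} added i′j′≢ij = EdgePlus⇒Edge G (edge i′ j′) λ same →
    ij-case i′j′≢ij (i′≡i (SamePair-endpoint added same))
                    (j′≡j (SamePair-endpoint added (SamePair-swap same)))
    where
    i′≡i : a i′ ≡ a i ⊎ a i′ ≡ b j → i′ ≡ i
    i′≡i (inj₁ p) = a-injective p
    i′≡i (inj₂ p) = ⊥-elim (a≢b i′ j p)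
    j′≡j : b j′ ≡ a i ⊎ b j′ ≡ b j → j′ ≡ j
    j′≡j (inj₁ p) = ⊥-elim (≢-sym (a≢b i j′) p)
    j′≡j (inj₂ p) = b-injective p
    ij-case : i′ ≢ i ⊎ j′ ≢ j → i′ ≡ i → j′ ≡ j → ⊥
    ij-case (inj₁ i′≢i) p _ = i′≢i p
    ij-case (inj₂ j′≢j) _ q = j′≢j q

  module _ {i j} (added : SamePair u v (a i) (b j)) where
    private
      i′ : Fin 2
      i′ = punchIn i zero
      j₁ j₂ : Fin 3
      j₁ = punchIn j zero
      j₂ = punchIn j (suc zero)

      b-j₁≢b-j₂ : b j₁ ≢ b j₂
      b-j₁≢b-j₂ p with punchIn-injective j zero (suc zero) (b-injective p)
      ... | ()

      a-i′-b-j : Edge G (a i′) (b j)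
      a-i′-b-j = K23-edges-in-G added (inj₁ (punchInᵢ≢i i zero))

      a-i′-b-j₁ : Edge G (a i′) (b j₁)
      a-i′-b-j₁ = K23-edges-in-G added (inj₁ (punchInᵢ≢i i zero))

      a-i′-b-j₂ : Edge G (a i′) (b j₂)
      a-i′-b-j₂ = K23-edges-in-G added (inj₁ (punchInᵢ≢i i zero))

      a-i-b-j₁ : Edge G (a i) (b j₁)
      a-i-b-j₁ = K23-edges-in-G added (inj₂ (punchInᵢ≢i j zero))

      a-i-b-j₂ : Edge G (a i) (b j₂)
      a-i-b-j₂ = K23-edges-in-G added (inj₂ (punchInᵢ≢i j (suc zero)))

    added-edge⇒adjacent-to-common-neighbour :
      AdjacentToCommonNeighbourOfNeighboursOf G (a i) (b j)
    added-edge⇒adjacent-to-common-neighbour =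
      b j₁ , b j₂ , a i′ , Edge⇒∈N G a-i-b-j₁ , Edge⇒∈N G a-i-b-j₂ , b-j₁≢b-j₂
      , x∈p∩q⁺ (Edge⇒∈N G (Edge-sym G a-i′-b-j₁) , Edge⇒∈N G (Edge-sym G a-i′-b-j₂))
      , Edge-sym G a-i′-b-j

    added-edge⇒shares-two-neighbours-with-neighbour :
      ShareTwoNeighboursWithNeighbourOf G (b j) (a i)
    added-edge⇒shares-two-neighbours-with-neighbour =
      a i′ , Edge⇒∈N G (Edge-sym G a-i′-b-j)
      , distinct-∈⇒2≤∣p∣ (x∈p∩q⁺ (Edge⇒∈N G a-i-b-j₁ , Edge⇒∈N G a-i′-b-j₁))
                          (x∈p∩q⁺ (Edge⇒∈N G a-i-b-j₂ , Edge⇒∈N G a-i′-b-j₂))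
                          b-j₁≢b-j₂

K23-uses-added-edge : ∀ (G : Graph n) {u v} → ¬ ContainsK23 (Edge G) →
  (K : K23 (EdgePlus G u v)) → ∃[ i ] ∃[ j ] SamePair u v (K23.a K i) (K23.b K j)
K23-uses-added-edge G noK K
  with all⊎any (λ i → all⊎any (λ j → K23.edge K i j))
... | inj₂ added = added
... | inj₁ old   = ⊥-elim (noK (K23⇒ContainsK23 record
  { a = a ; b = b ; a-injective = a-injective ; b-injective = b-injective ; a≢b = a≢b ; edge = old }))
  where open K23 K

added-edge-K23⇒non-neighbour-structure : ∀ (G : Graph n) {α y} → ¬ ContainsK23 (Edge G) →
  K23 (EdgePlus G α y) →
  ShareTwoNeighboursWithNeighbourOf G α y ⊎ AdjacentToCommonNeighbourOfNeighboursOf G α y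
added-edge-K23⇒non-neighbour-structure G noK K with K23-uses-added-edge G noK K
... | i , j , added@(inj₁ (a-i≡α , b-j≡y)) =
  inj₂ (subst₂ (AdjacentToCommonNeighbourOfNeighboursOf G) a-i≡α b-j≡y
         (added-edge⇒adjacent-to-common-neighbour G K added))
... | i , j , added@(inj₂ (a-i≡y , b-j≡α)) =
  inj₁ (subst₂ (ShareTwoNeighboursWithNeighbourOf G) b-j≡α a-i≡y
         (added-edge⇒shares-two-neighbours-with-neighbour G K added))

saturated⇒non-neighbour-structure : ∀ (G : Graph n) → K23Saturated G → ∀ α y → ¬ (y ∈N[ G , α ]) →
  ShareTwoNeighboursWithNeighbourOf G α y ⊎ AdjacentToCommonNeighbourOfNeighboursOf G α y
saturated⇒non-neighbour-structure G (noK , saturated) α y y∉N[α] =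
  added-edge-K23⇒non-neighbour-structure G noK
    (ContainsK23⇒K23 (saturated α y (y∉N[α] ∘ inj₁ ∘ ≡-sym) (y∉N[α] ∘ inj₂ ∘ Edge⇒∈N G)))

corollary3p2 : ∀ {n} (G : Graph n) → K23Saturated G → (α : Fin n) →
    ((y : Fin n) → ¬ (y ∈N[ G , α ]) →
      (∃[ x ] (x ∈ N G α × ∣ N G y ∩ N G x ∣ ≥ 2))
      ⊎ (∃[ xi ] ∃[ xj ] ∃[ z ] (xi ∈ N G α × xj ∈ N G α × xi ≢ xj
           × z ∈ (N G xi ∩ N G xj) × Edge G y z)))
    × (∣ N G α ∣ ≡ 1 → (x₁ : Fin n) → x₁ ∈ N G α →
        (y : Fin n) → ¬ (y ∈N[ G , α ]) → ∣ N G y ∩ N G x₁ ∣ ≥ 2)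
corollary3p2 G saturated α = structure , single-neighbour
  where
  structure : ∀ y → ¬ (y ∈N[ G , α ]) →
    ShareTwoNeighboursWithNeighbourOf G α y ⊎ AdjacentToCommonNeighbourOfNeighboursOf G α y
  structure = saturated⇒non-neighbour-structure G saturated α

  single-neighbour : ∣ N G α ∣ ≡ 1 → ∀ x₁ → x₁ ∈ N G α →
                     ∀ y → ¬ (y ∈N[ G , α ]) → ∣ N G y ∩ N G x₁ ∣ ≥ 2
  single-neighbour ∣Nα∣≡1 x₁ x₁∈Nα y y∉N[α] with structure y y∉N[α]
  ... | inj₁ (x , x∈Nα , shared) =
    subst (λ x → ∣ N G y ∩ N G x ∣ ≥ 2) (∣p∣≡1⇒∈-unique ∣Nα∣≡1 x∈Nα x₁∈Nα) shared
  ... | inj₂ (xi , xj , _ , xi∈Nα , xj∈Nα , xi≢xj , _) =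
    ⊥-elim (xi≢xj (∣p∣≡1⇒∈-unique ∣Nα∣≡1 xi∈Nα xj∈Nα))
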